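{- Let $R$ be a commutative ring of formal power series (over a field containing $\mathbb{Q}$ and the parameter $\alpha$) in variables $y, w, \dots$, and let $\mathcal{L}$ be the $R$-linear functional on $R[A]$ defined by $\mathcal{L}(A^n)=(\alpha)_n$ for all $n\ge 0$, extended to admissible power series in $A$. Then for every admissible formal power series $f(z)\in R[[z]]$, \[\mathcal{L}\bigl(e^{Ay}f(A)\bigr)=\frac{1}{(1-y)^{\alpha}}\,\mathcal{L}\!\left(f\!\left(\frac{A}{1-y}\right)\right).\]
   Context: $(\alpha)_n=\alpha(\alpha+1)\cdots(\alpha+n-1)$ denotes the rising factorial, with $(\alpha)_0=1$; $(1-y)^{ -\alpha}=\sum_{n\ge0}(\alpha)_n y^n/n!$. A formal power series $g(z)=\sum_i g_i z^i$ with coefficients $g_i\in R$ is called admissible if for every monomial in the variables of $R$, its coefficient in $g(z)$ is a polynomial in $z$; for admissible $g$ one defines $\mathcal{L}(g(A))=\sum_i g_i\,\mathcal{L}(A^i)$, which is a well-defined element of $R$. -}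

module Defs where

open import Level using (Level; _⊔_)
open import Data.Nat as ℕ using (ℕ; zero; suc; _≤_; _∸_; _!)
open import Data.Nat.Properties using (_!≢0)
open import Data.Vec as Vec using (Vec; _∷_; []; replicate)
open import Data.Vec.Properties using (≡-dec)
open import Data.List as List using (List)
open import Data.Product using (Σ; _,_)
open import Data.Integer using (+_)
import Data.Rational as ℚ
open import Data.Rational.Properties using (+-*-commutativeRing)
open import Algebra.Bundles using (CommutativeRing)
open import Algebra.Morphism.Structures using (module RingMorphisms)
open import Relation.Nullary using (¬_; yes; no)

record RatField (c ℓ : Level) : Set (Level.suc (c ⊔ ℓ)) where
  field
    commRing : CommutativeRing c ℓ
  open CommutativeRing commRing public
  field
    ι       : ℚ.ℚ → Carrier
    ι-hom   : RingMorphisms.IsRingHomomorphism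
                (CommutativeRing.rawRing +-*-commutativeRing) rawRing ι
    1≉0     : ¬ (1# ≈ 0#)
    inverse : ∀ x → ¬ (x ≈ 0#) → Σ Carrier (λ y → x * y ≈ 1#)

-- R = K[[y, w₁, …, wₘ]] : formal power series over K in the variable y and
-- m further variables.  A monomial is an exponent vector whose head is the
-- exponent of y; a series is its coefficient function.
module PowerSeries {c ℓ} (F : RatField c ℓ) (m : ℕ) where
  open RatField F

  Mono : Set
  Mono = Vec ℕ (suc m)

  Series : Set c
  Series = Mono → Carrier

  _≈ₛ_ : Series → Series → Set ℓ
  g ≈ₛ h = ∀ e → g e ≈ h e

  sumL : List Carrier → Carrier
  sumL = List.foldr _+_ 0#

  below : ∀ {n} → Vec ℕ n → List (Vec ℕ n)
  below []      = List.[ [] ]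
  below (k ∷ e) = List.concatMap (λ j → List.map (j ∷_) (below e)) (List.upTo (suc k))

  _⊗_ : Series → Series → Series
  (g ⊗ h) e = sumL (List.map (λ d → g d * h (Vec.zipWith _∸_ e d)) (below e))

  term : Carrier → Mono → Series
  term a d e with ≡-dec ℕ._≟_ d e
  ... | yes _ = a
  ... | no  _ = 0#

  yPow : ℕ → Mono
  yPow k = k ∷ replicate m 0

  oneₛ : Series
  oneₛ = term 1# (yPow 0)

  _^ₛ_ : Series → ℕ → Series
  g ^ₛ zero  = oneₛ
  g ^ₛ suc n = g ⊗ (g ^ₛ n)

  fromℕ : ℕ → Carrier
  fromℕ zero    = 0#
  fromℕ (suc n) = 1# + fromℕ n

  poch : Carrier → ℕ → Carrier
  poch α zero    = 1#
  poch α (suc n) = poch α n * (α + fromℕ n)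

  invFact : ℕ → Carrier
  invFact k = ι (ℚ._/_ (+ 1) (k !) {{k !≢0}})

  -- (1 - y)^{-1} = Σ_k y^k
  geom : Series
  geom (k ∷ w) = term 1# (yPow k) (k ∷ w)

  -- (1 - y)^{-α} = Σ_k (α)_k y^k / k!
  binomNeg : Carrier → Series
  binomNeg α (k ∷ w) = term (poch α k * invFact k) (yPow k) (k ∷ w)

  ZSeries : Set c
  ZSeries = ℕ → Series

  sumS : List Series → Series
  sumS gs e = sumL (List.map (λ g → g e) gs)

  -- admissible: for every monomial e, the coefficient of e in g(z) is a
  -- polynomial in z, i.e. g_i(e) = 0 for all i ≥ N(e)
  Admissible : ZSeries → Set ℓ
  Admissible g = Σ (Mono → ℕ) (λ N → ∀ e i → N e ≤ i → g i e ≈ 0#)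

  -- 𝓛(g(A)) = Σ_i g_i (α)_i   (finite at each monomial by admissibility)
  𝓛 : Carrier → (g : ZSeries) → Admissible g → Series
  𝓛 α g (N , _) e = sumL (List.map (λ i → g i e * poch α i) (List.upTo (N e)))

  -- e^{zy} f(z), as a series in z: coefficient of z^n is Σ_{k+i=n} (y^k/k!) f_i
  expY⋆ : ZSeries → ZSeries
  expY⋆ f n = sumS (List.map (λ k → term (invFact k) (yPow k) ⊗ f (n ∸ k)) (List.upTo (suc n)))

  -- f(z/(1-y)) = Σ_i f_i z^i (1-y)^{-i}
  substGeom : ZSeries → ZSeries
  substGeom f i = f i ⊗ (geom ^ₛ i)

module Submission where

-- Fix a monomial y^K w and write F_i(l) for the coefficient of y^l w in f_i.  Both sides
-- have coefficient  Σ_i (α)_i [y^K] (1-y)^{-(α+i)} Σ_l F_i(l) y^l  at y^K w.  On the left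
-- this is the splitting (α)_{k+i} = (α)_i (α+i)_k of the rising factorial.  On the right it
-- is (1-y)^{-α} (1-y)^{-i} = (1-y)^{-(α+i)}, which follows by induction on i from the
-- hockey-stick identity Σ_{j≤t} (β)_j/j! = (β+1)_t/t!.  Admissibility of f bounds the
-- indices i that contribute, uniformly in l ≤ K, so every sum involved is finite.

open import Defs
open import Algebra.Bundles using (CommutativeSemiring)
open import Algebra.Morphism.Structures using (module RingMorphisms)
import Data.Integer as ℤ
import Data.Integer.Properties as ℤ
open import Data.Integer using (+_)
import Data.List as List
open import Data.List using (List)
open import Data.List.Properties using (map-++; map-∘; upTo-∷ʳ)
import Data.Nat as ℕ
import Data.Nat.Properties as ℕ
open import Data.Nat using (ℕ; zero; suc; _∸_; _≤_; _<_; _≟_; _⊔_; _!; z≤n; s≤s; NonZero)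
open import Data.Nat.Coprimality using (1-coprimeTo)
import Data.Nat.Coprimality as Coprimality
open import Data.Nat.Properties
  using (m<n⇒m<1+n; n<1+n; m<1+n⇒m≤n; <⇒≢; ≤∧≢⇒<; m≤n⇒m<n∨m≡n; m≤m+n; m≤n+m; +-∸-assoc;
         n∸n≡0; m+n≤o⇒m≤o; m+n≤o⇒m≤o∸n; +-monoʳ-≤; <⇒≤; ≤-trans; ≤-refl; ≤-<-trans; m∸n≤m;
         m∸[m∸n]≡n; m+[n∸m]≡n; ∸-+-assoc; m<n⇒0<n∸m; m≤m⊔n; m≤n⊔m; m*n≢0; _!≢0)
open import Data.Product using (Σ-syntax; _,_)
open import Data.Rational using (ℚ; _/_; 1ℚ; mkℚ)
import Data.Rational as ℚ
open import Data.Rational.Properties using (↥p/↧p≡p; /-cong; fromℚᵘ-cong)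
import Data.Rational.Unnormalised as ℚᵘ
import Data.Rational.Unnormalised.Properties as ℚᵘ
open import Data.Sum using (inj₁; inj₂)
open import Data.Vec as Vec using (Vec; _∷_; []; replicate)
open import Data.Vec.Properties using (≡-dec; map-id; zipWith-identityʳ; zipWith-inverseʳ)
open import Function using (_∘_)
open import Relation.Binary.PropositionalEquality using (_≡_; _≢_; cong; cong₂; subst)
import Relation.Binary.PropositionalEquality as ≡
open import Relation.Nullary using (yes; no; contradiction)

[1+n]/1≡1+n/1 : ∀ n → + suc n / 1 ≡ 1ℚ ℚ.+ + n / 1
[1+n]/1≡1+n/1 n = begin
  + suc n / 1                                 ≡⟨ /-cong {q₁ = 1} numerator ≡.refl ⟨
  (+ 1 ℤ.* + 1 ℤ.+ + n ℤ.* + 1) / 1           ≡⟨ cong (λ q → 1ℚ ℚ.+ q) (↥p/↧p≡p n/1) ⟨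
  1ℚ ℚ.+ + n / 1                              ∎
  where
  open ≡.≡-Reasoning
  n/1 : ℚ
  n/1 = mkℚ (+ n) 0 (Coprimality.sym (1-coprimeTo n))
  numerator : + 1 ℤ.* + 1 ℤ.+ + n ℤ.* + 1 ≡ + suc n
  numerator = cong (λ z → + 1 ℤ.+ z) (ℤ.*-identityʳ (+ n))

1/n≡[1+a]/1*1/[[1+a]*n] : ∀ a n .{{_ : NonZero n}} →
  + 1 / n ≡ (+ suc a / 1) ℚ.* (+ 1 / (suc a ℕ.* n)) {{m*n≢0 (suc a) n}}
1/n≡[1+a]/1*1/[[1+a]*n] a (suc d) = begin
  + 1 / suc d
    ≡⟨ fromℚᵘ-cong cancel ⟨
  (+ suc a ℤ.* + 1) / (1 ℕ.* (suc a ℕ.* suc d))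
    ≡⟨ cong₂ ℚ._*_ (↥p/↧p≡p [1+a]/1) (↥p/↧p≡p 1/[[1+a]*n]) ⟨
  (+ suc a / 1) ℚ.* (+ 1 / (suc a ℕ.* suc d))
    ∎
  where
  open ≡.≡-Reasoning
  [1+a]/1 : ℚ
  [1+a]/1 = mkℚ (+ suc a) 0 (Coprimality.sym (1-coprimeTo _))
  1/[[1+a]*n] : ℚ
  1/[[1+a]*n] = mkℚ (+ 1) (d ℕ.+ a ℕ.* suc d) (1-coprimeTo _)
  cancel : (+ suc a ℤ.* + 1) ℚᵘ./ (1 ℕ.* (suc a ℕ.* suc d)) ℚᵘ.≃ + 1 ℚᵘ./ suc d
  cancel = ℚᵘ.≃-trans (ℚᵘ.≃-reflexive (ℚᵘ./-cong ≡.refl (ℕ.*-identityˡ (suc a ℕ.* suc d))))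
                      (ℚᵘ.*-cancelˡ-/ (suc a) {+ 1} {suc d})

maxUpTo : (ℕ → ℕ) → ℕ → ℕ
maxUpTo N zero    = N 0
maxUpTo N (suc k) = maxUpTo N k ⊔ N (suc k)

≤-maxUpTo : ∀ N {l} k → l ≤ k → N l ≤ maxUpTo N k
≤-maxUpTo N zero    z≤n   = ≤-refl
≤-maxUpTo N (suc k) l≤1+k with m≤n⇒m<n∨m≡n l≤1+k
... | inj₁ l<1+k  = ≤-trans (≤-maxUpTo N k (m<1+n⇒m≤n l<1+k)) (m≤m⊔n _ _)
... | inj₂ ≡.refl = m≤n⊔m _ _

module NatIndexedSum {c ℓ} (R : CommutativeSemiring c ℓ) where

  open CommutativeSemiring R
  open import Algebra.Properties.CommutativeSemigroup +-commutativeSemigroup using (interchange)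
  open import Relation.Binary.Reasoning.Setoid setoid

  ∑< : ℕ → (ℕ → Carrier) → Carrier
  ∑< zero    g = 0#
  ∑< (suc n) g = ∑< n g + g n

  syntax ∑< n (λ i → x) = ∑[ i < n ] x

  ∑-cong : ∀ n {g h : ℕ → Carrier} → (∀ i → i < n → g i ≈ h i) → ∑< n g ≈ ∑< n h
  ∑-cong zero    _  = refl
  ∑-cong (suc n) eq = +-cong (∑-cong n (λ i i<n → eq i (m<n⇒m<1+n i<n))) (eq n (n<1+n n))

  ∑-zero : ∀ n {g : ℕ → Carrier} → (∀ i → i < n → g i ≈ 0#) → ∑< n g ≈ 0#
  ∑-zero zero    _  = refl
  ∑-zero (suc n) eq =
    trans (+-cong (∑-zero n (λ i i<n → eq i (m<n⇒m<1+n i<n))) (eq n (n<1+n n))) (+-identityʳ 0#)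

  ∑-distrib-+ : ∀ n (g h : ℕ → Carrier) → ∑[ i < n ] (g i + h i) ≈ ∑< n g + ∑< n h
  ∑-distrib-+ zero    g h = sym (+-identityʳ 0#)
  ∑-distrib-+ (suc n) g h = trans (+-congʳ (∑-distrib-+ n g h)) (interchange _ _ _ _)

  *-distribˡ-∑ : ∀ n x (g : ℕ → Carrier) → x * ∑< n g ≈ ∑[ i < n ] (x * g i)
  *-distribˡ-∑ zero    x g = zeroʳ x
  *-distribˡ-∑ (suc n) x g = trans (distribˡ x _ _) (+-congʳ (*-distribˡ-∑ n x g))

  *-distribʳ-∑ : ∀ n x (g : ℕ → Carrier) → ∑< n g * x ≈ ∑[ i < n ] (g i * x)
  *-distribʳ-∑ zero    x g = zeroˡ x
  *-distribʳ-∑ (suc n) x g = trans (distribʳ x _ _) (+-congʳ (*-distribʳ-∑ n x g))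

  ∑-comm : ∀ m n (a : ℕ → ℕ → Carrier) → ∑[ i < m ] ∑[ j < n ] a i j ≈ ∑[ j < n ] ∑[ i < m ] a i j
  ∑-comm zero    n a = sym (∑-zero n (λ _ _ → refl))
  ∑-comm (suc m) n a = trans (+-congʳ (∑-comm m n a)) (sym (∑-distrib-+ n _ (a m)))

  ∑-suc : ∀ n (g : ℕ → Carrier) → ∑< (suc n) g ≈ g 0 + ∑[ i < n ] g (suc i)
  ∑-suc zero    g = +-comm 0# (g 0)
  ∑-suc (suc n) g = trans (+-congʳ (∑-suc n g)) (+-assoc _ _ _)

  ∑-reverse : ∀ n (g : ℕ → Carrier) → ∑[ j < suc n ] g (n ∸ j) ≈ ∑< (suc n) g
  ∑-reverse zero    g = refl
  ∑-reverse (suc n) g = trans (∑-suc (suc n) _) (trans (+-congˡ (∑-reverse n g)) (+-comm _ _))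

  ∑-single : ∀ n j {g : ℕ → Carrier} → j < n → (∀ i → i < n → i ≢ j → g i ≈ 0#) → ∑< n g ≈ g j
  ∑-single (suc n) j j<1+n others with j ≟ n
  ... | yes ≡.refl =
    trans (+-congʳ (∑-zero n (λ i i<n → others i (m<n⇒m<1+n i<n) (<⇒≢ i<n)))) (+-identityˡ _)
  ... | no j≢n = trans
    (+-cong (∑-single n j (≤∧≢⇒< (m<1+n⇒m≤n j<1+n) j≢n) (λ i i<n → others i (m<n⇒m<1+n i<n)))
            (others n (n<1+n n) (j≢n ∘ ≡.sym)))
    (+-identityʳ _)

  ∑-extend : ∀ {N} M {g : ℕ → Carrier} → (∀ i → N ≤ i → g i ≈ 0#) → N ≤ M → ∑< M g ≈ ∑< N g
  ∑-extend zero    _      z≤n   = refl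
  ∑-extend (suc M) vanish N≤1+M with m≤n⇒m<n∨m≡n N≤1+M
  ... | inj₂ ≡.refl  = refl
  ... | inj₁ N<1+M = trans
    (+-cong (∑-extend M vanish (m<1+n⇒m≤n N<1+M)) (vanish M (m<1+n⇒m≤n N<1+M)))
    (+-identityʳ _)

  ∑-bound-irrelevant : ∀ N₁ N₂ {g : ℕ → Carrier} →
    (∀ i → N₁ ≤ i → g i ≈ 0#) → (∀ i → N₂ ≤ i → g i ≈ 0#) → ∑< N₁ g ≈ ∑< N₂ g
  ∑-bound-irrelevant N₁ N₂ vanish₁ vanish₂ =
    trans (sym (∑-extend (N₁ ℕ.+ N₂) vanish₁ (m≤m+n N₁ N₂)))
          (∑-extend (N₁ ℕ.+ N₂) vanish₂ (m≤n+m N₂ N₁))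

  ∑-triangle : ∀ M (a : ℕ → ℕ → Carrier) →
    ∑[ n < M ] ∑[ k < suc n ] a k (n ∸ k) ≈ ∑[ k < M ] ∑[ i < M ∸ k ] a k i
  ∑-triangle zero    a = refl
  ∑-triangle (suc M) a = begin
    ∑[ n < M ] ∑[ k < suc n ] a k (n ∸ k) + ∑[ k < suc M ] a k (M ∸ k)
      ≈⟨ +-congʳ (∑-triangle M a) ⟩
    ∑[ k < M ] ∑[ i < M ∸ k ] a k i + ∑[ k < suc M ] a k (M ∸ k)
      ≈⟨ +-congʳ (+-identityʳ _) ⟨
    (∑[ k < M ] ∑[ i < M ∸ k ] a k i + 0#) + ∑[ k < suc M ] a k (M ∸ k)
      ≈⟨ +-congʳ (+-congˡ (reflexive (cong (λ t → ∑< t (a M)) (n∸n≡0 M)))) ⟨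
    ∑[ k < suc M ] ∑[ i < M ∸ k ] a k i + ∑[ k < suc M ] a k (M ∸ k)
      ≈⟨ ∑-distrib-+ (suc M) _ _ ⟨
    ∑[ k < suc M ] ∑[ i < suc (M ∸ k) ] a k i
      ≈⟨ ∑-cong (suc M) (λ k k<1+M →
           reflexive (cong (λ t → ∑< t (a k)) (≡.sym (+-∸-assoc 1 (m<1+n⇒m≤n k<1+M))))) ⟩
    ∑[ k < suc M ] ∑[ i < suc M ∸ k ] a k i ∎

  ∑-antidiagonal : ∀ {P Q} M (a : ℕ → ℕ → Carrier) →
    (∀ k i → P ≤ k → a k i ≈ 0#) → (∀ k i → Q ≤ i → a k i ≈ 0#) → P ℕ.+ Q ≤ M →
    ∑[ n < M ] ∑[ k < suc n ] a k (n ∸ k) ≈ ∑[ k < P ] ∑[ i < Q ] a k i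
  ∑-antidiagonal {P} {Q} M a vanishₖ vanishᵢ P+Q≤M = begin
    ∑[ n < M ] ∑[ k < suc n ] a k (n ∸ k)
      ≈⟨ ∑-triangle M a ⟩
    ∑[ k < M ] ∑[ i < M ∸ k ] a k i
      ≈⟨ ∑-extend M (λ k P≤k → ∑-zero (M ∸ k) (λ i _ → vanishₖ k i P≤k)) (m+n≤o⇒m≤o P P+Q≤M) ⟩
    ∑[ k < P ] ∑[ i < M ∸ k ] a k i
      ≈⟨ ∑-cong P (λ k k<P → ∑-extend (M ∸ k) (vanishᵢ k) (m+n≤o⇒m≤o∸n Q (Q+k≤M k<P))) ⟩
    ∑[ k < P ] ∑[ i < Q ] a k i ∎
    where
    Q+k≤M : ∀ {k} → k < P → Q ℕ.+ k ≤ M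
    Q+k≤M k<P = ≤-trans (+-monoʳ-≤ Q (<⇒≤ k<P)) (subst (_≤ M) (ℕ.+-comm P Q) P+Q≤M)

  infixl 7 _⋆_

  _⋆_ : (ℕ → Carrier) → (ℕ → Carrier) → ℕ → Carrier
  (a ⋆ b) t = ∑[ j < suc t ] (a j * b (t ∸ j))

  ⋆-cong : ∀ {a a′ b b′ : ℕ → Carrier} t →
    (∀ s → s ≤ t → a s ≈ a′ s) → (∀ s → s ≤ t → b s ≈ b′ s) → (a ⋆ b) t ≈ (a′ ⋆ b′) t
  ⋆-cong t a≈a′ b≈b′ =
    ∑-cong (suc t) (λ j j≤t → *-cong (a≈a′ j (m<1+n⇒m≤n j≤t)) (b≈b′ (t ∸ j) (m∸n≤m t j)))

  ⋆-comm : ∀ (a b : ℕ → Carrier) t → (a ⋆ b) t ≈ (b ⋆ a) t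
  ⋆-comm a b t = begin
    ∑[ j < suc t ] (a j * b (t ∸ j))
      ≈⟨ ∑-reverse t _ ⟨
    ∑[ j < suc t ] (a (t ∸ j) * b (t ∸ (t ∸ j)))
      ≈⟨ ∑-cong (suc t) (λ j j<1+t → trans (*-comm _ _)
           (*-congʳ (reflexive (cong b (m∸[m∸n]≡n (m<1+n⇒m≤n j<1+t)))))) ⟩
    ∑[ j < suc t ] (b j * a (t ∸ j)) ∎

  ⋆-assoc : ∀ (a b c : ℕ → Carrier) t → ((a ⋆ b) ⋆ c) t ≈ (a ⋆ (b ⋆ c)) t
  ⋆-assoc a b c t = begin
    ∑[ n < suc t ] ((a ⋆ b) n * c (t ∸ n))
      ≈⟨ ∑-cong (suc t) (λ n _ → trans (*-distribʳ-∑ (suc n) _ _) (∑-cong (suc n) (λ k k<1+n →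
           trans (*-assoc _ _ _) (*-congˡ (*-congˡ (reflexive (cong (λ s → c (t ∸ s))
             (≡.sym (m+[n∸m]≡n (m<1+n⇒m≤n k<1+n)))))))))) ⟩
    ∑[ n < suc t ] ∑[ k < suc n ] A k (n ∸ k)
      ≈⟨ ∑-triangle (suc t) A ⟩
    ∑[ k < suc t ] ∑[ p < suc t ∸ k ] A k p
      ≈⟨ ∑-cong (suc t) (λ k k<1+t → begin
           ∑[ p < suc t ∸ k ] A k p
             ≈⟨ reflexive (cong (λ s → ∑< s (A k)) (+-∸-assoc 1 (m<1+n⇒m≤n k<1+t))) ⟩
           ∑[ p < suc (t ∸ k) ] A k p
             ≈⟨ ∑-cong (suc (t ∸ k)) (λ p _ →
                  *-congˡ (*-congˡ (reflexive (cong c (≡.sym (∸-+-assoc t k p)))))) ⟩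
           ∑[ p < suc (t ∸ k) ] (a k * (b p * c (t ∸ k ∸ p)))
             ≈⟨ *-distribˡ-∑ (suc (t ∸ k)) (a k) _ ⟨
           a k * (b ⋆ c) (t ∸ k) ∎) ⟩
    ∑[ k < suc t ] (a k * (b ⋆ c) (t ∸ k)) ∎
    where
    A : ℕ → ℕ → Carrier
    A k p = a k * (b p * c (t ∸ (k ℕ.+ p)))

  ⋆-vanishesˡ : ∀ {a b : ℕ → Carrier} t → (∀ s → s ≤ t → a s ≈ 0#) → (a ⋆ b) t ≈ 0#
  ⋆-vanishesˡ t a≈0 =
    ∑-zero (suc t) (λ j j<1+t → trans (*-congʳ (a≈0 j (m<1+n⇒m≤n j<1+t))) (zeroˡ _))

  ⋆-vanishesʳ : ∀ {a b : ℕ → Carrier} t → (∀ s → s ≤ t → b s ≈ 0#) → (a ⋆ b) t ≈ 0#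
  ⋆-vanishesʳ t b≈0 = ∑-zero (suc t) (λ j _ → trans (*-congˡ (b≈0 (t ∸ j) (m∸n≤m t j))) (zeroʳ _))

  ⋆-concentratedˡ : ∀ {a b : ℕ → Carrier} {k t} →
    (∀ j → j ≢ k → a j ≈ 0#) → k ≤ t → (a ⋆ b) t ≈ a k * b (t ∸ k)
  ⋆-concentratedˡ a≈0 k≤t =
    ∑-single _ _ (s≤s k≤t) (λ j _ j≢k → trans (*-congʳ (a≈0 j j≢k)) (zeroˡ _))

  ⋆-ones : ∀ (a : ℕ → Carrier) t → (a ⋆ (λ _ → 1#)) t ≈ ∑< (suc t) a
  ⋆-ones a t = ∑-cong (suc t) (λ j _ → *-identityʳ (a j))

  ⋆-distribˡ-∑ : ∀ n (a : ℕ → Carrier) (b : ℕ → ℕ → Carrier) (x : ℕ → Carrier) t →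
    (a ⋆ (λ s → ∑[ i < n ] (b i s * x i))) t ≈ ∑[ i < n ] ((a ⋆ b i) t * x i)
  ⋆-distribˡ-∑ n a b x t = begin
    ∑[ j < suc t ] (a j * ∑[ i < n ] (b i (t ∸ j) * x i))
      ≈⟨ ∑-cong (suc t) (λ j _ → *-distribˡ-∑ n (a j) _) ⟩
    ∑[ j < suc t ] ∑[ i < n ] (a j * (b i (t ∸ j) * x i))
      ≈⟨ ∑-comm (suc t) n _ ⟩
    ∑[ i < n ] ∑[ j < suc t ] (a j * (b i (t ∸ j) * x i))
      ≈⟨ ∑-cong n (λ i _ → trans (∑-cong (suc t) (λ j _ → sym (*-assoc _ _ _)))
                                  (sym (*-distribʳ-∑ (suc t) (x i) _))) ⟩
    ∑[ i < n ] ((a ⋆ b i) t * x i) ∎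

module PowerSeriesProperties {c ℓ} (F : RatField c ℓ) (m : ℕ) where

  open RatField F hiding (zero)
  open PowerSeries F m
  open NatIndexedSum commutativeSemiring
  open RingMorphisms.IsRingHomomorphism ι-hom using (+-homo; *-homo; 0#-homo; 1#-homo)
  open import Algebra.Solver.Ring.NaturalCoefficients.Default commutativeSemiring
    using (solve; _:+_; _:*_; _:=_)
  open import Relation.Binary.Reasoning.Setoid setoid

  sumL-++ : ∀ xs ys → sumL (xs List.++ ys) ≈ sumL xs + sumL ys
  sumL-++ List.[]       ys = sym (+-identityˡ _)
  sumL-++ (x List.∷ xs) ys = trans (+-congˡ (sumL-++ xs ys)) (sym (+-assoc _ _ _))

  sumL-zero : ∀ {A : Set} (φ : A → Carrier) xs → (∀ x → φ x ≈ 0#) → sumL (List.map φ xs) ≈ 0#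
  sumL-zero φ List.[]       _   = refl
  sumL-zero φ (x List.∷ xs) φ≈0 = trans (+-cong (φ≈0 x) (sumL-zero φ xs φ≈0)) (+-identityʳ 0#)

  sumL-concatMap : ∀ {A B : Set} (φ : B → Carrier) (G : A → List B) xs →
    sumL (List.map φ (List.concatMap G xs)) ≈ sumL (List.map (λ x → sumL (List.map φ (G x))) xs)
  sumL-concatMap φ G List.[]       = refl
  sumL-concatMap φ G (x List.∷ xs) = begin
    sumL (List.map φ (G x List.++ List.concatMap G xs))
      ≡⟨ cong sumL (map-++ φ (G x) _) ⟩
    sumL (List.map φ (G x) List.++ List.map φ (List.concatMap G xs))
      ≈⟨ sumL-++ (List.map φ (G x)) _ ⟩
    sumL (List.map φ (G x)) + sumL (List.map φ (List.concatMap G xs))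
      ≈⟨ +-congˡ (sumL-concatMap φ G xs) ⟩
    sumL (List.map φ (G x)) + sumL (List.map (λ x → sumL (List.map φ (G x))) xs) ∎

  sumL-upTo : ∀ n (g : ℕ → Carrier) → sumL (List.map g (List.upTo n)) ≈ ∑< n g
  sumL-upTo zero    g = refl
  sumL-upTo (suc n) g = begin
    sumL (List.map g (List.upTo (suc n)))
      ≡⟨ cong (sumL ∘ List.map g) (upTo-∷ʳ n) ⟨
    sumL (List.map g (List.upTo n List.++ List.[ n ]))
      ≡⟨ cong sumL (map-++ g (List.upTo n) List.[ n ]) ⟩
    sumL (List.map g (List.upTo n) List.++ List.[ g n ])
      ≈⟨ sumL-++ (List.map g (List.upTo n)) _ ⟩
    sumL (List.map g (List.upTo n)) + (g n + 0#)
      ≈⟨ +-cong (sumL-upTo n g) (+-identityʳ _) ⟩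
    ∑< n g + g n ∎

  sumS-upTo : ∀ n (h : ℕ → Series) e → sumS (List.map h (List.upTo n)) e ≈ ∑[ k < n ] h k e
  sumS-upTo n h e = trans (reflexive (cong sumL (≡.sym (map-∘ (List.upTo n))))) (sumL-upTo n _)

  sumL-below-∷ : ∀ {n} k (v : Vec ℕ n) (φ : Vec ℕ (suc n) → Carrier) →
    sumL (List.map φ (below (k ∷ v))) ≈ ∑[ j < suc k ] sumL (List.map (λ d → φ (j ∷ d)) (below v))
  sumL-below-∷ k v φ = begin
    sumL (List.map φ (below (k ∷ v)))
      ≈⟨ sumL-concatMap φ (λ j → List.map (j ∷_) (below v)) (List.upTo (suc k)) ⟩
    sumL (List.map (λ j → sumL (List.map φ (List.map (j ∷_) (below v)))) (List.upTo (suc k)))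
      ≈⟨ sumL-upTo (suc k) _ ⟩
    ∑[ j < suc k ] sumL (List.map φ (List.map (j ∷_) (below v)))
      ≈⟨ ∑-cong (suc k) (λ j _ → reflexive (cong sumL (≡.sym (map-∘ (below v))))) ⟩
    ∑[ j < suc k ] sumL (List.map (λ d → φ (j ∷ d)) (below v)) ∎

  sumL-below-origin : ∀ {n} (v : Vec ℕ n) (ψ : Vec ℕ n → Carrier) →
    (∀ d → d ≢ replicate n 0 → ψ d ≈ 0#) → sumL (List.map ψ (below v)) ≈ ψ (replicate n 0)
  sumL-below-origin []      ψ _   = +-identityʳ _
  sumL-below-origin (k ∷ v) ψ ψ≈0 = begin
    sumL (List.map ψ (below (k ∷ v)))
      ≈⟨ sumL-below-∷ k v ψ ⟩
    ∑[ j < suc k ] sumL (List.map (λ d → ψ (j ∷ d)) (below v))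
      ≈⟨ ∑-single (suc k) 0 (s≤s z≤n) (λ j _ j≢0 →
           sumL-zero _ (below v) (λ d → ψ≈0 (j ∷ d) (j≢0 ∘ cong Vec.head))) ⟩
    sumL (List.map (λ d → ψ (0 ∷ d)) (below v))
      ≈⟨ sumL-below-origin v _ (λ d d≢0 → ψ≈0 (0 ∷ d) (d≢0 ∘ cong Vec.tail)) ⟩
    ψ (replicate _ 0) ∎

  sumL-below-top : ∀ {n} (v : Vec ℕ n) (ψ : Vec ℕ n → Carrier) →
    (∀ d → Vec.zipWith _∸_ v d ≢ replicate n 0 → ψ d ≈ 0#) → sumL (List.map ψ (below v)) ≈ ψ v
  sumL-below-top []      ψ _   = +-identityʳ _
  sumL-below-top (k ∷ v) ψ ψ≈0 = begin
    sumL (List.map ψ (below (k ∷ v)))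
      ≈⟨ sumL-below-∷ k v ψ ⟩
    ∑[ j < suc k ] sumL (List.map (λ d → ψ (j ∷ d)) (below v))
      ≈⟨ ∑-single (suc k) k (n<1+n k) (λ j j<1+k j≢k →
           sumL-zero _ (below v) (λ d → ψ≈0 (j ∷ d) (λ eq →
             <⇒≢ (m<n⇒0<n∸m (≤∧≢⇒< (m<1+n⇒m≤n j<1+k) j≢k)) (≡.sym (cong Vec.head eq))))) ⟩
    sumL (List.map (λ d → ψ (k ∷ d)) (below v))
      ≈⟨ sumL-below-top v _ (λ d ne → ψ≈0 (k ∷ d) (ne ∘ cong Vec.tail)) ⟩
    ψ (k ∷ v) ∎

  yCoeffs : Series → Vec ℕ m → ℕ → Carrier
  yCoeffs g w l = g (l ∷ w)

  yCoeffs₀ : Series → ℕ → Carrier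
  yCoeffs₀ g = yCoeffs g (replicate m 0)

  IsSeriesInY : Series → Set ℓ
  IsSeriesInY g = ∀ j d → d ≢ replicate m 0 → g (j ∷ d) ≈ 0#

  ⊗-IsSeriesInYˡ : ∀ {g h} → IsSeriesInY g → ∀ K w → (g ⊗ h) (K ∷ w) ≈ (yCoeffs₀ g ⋆ yCoeffs h w) K
  ⊗-IsSeriesInYˡ {g} {h} g∈Y K w = trans (sumL-below-∷ K w _) (∑-cong (suc K) (λ j _ → trans
    (sumL-below-origin w _ (λ d d≢0 → trans (*-congʳ (g∈Y j d d≢0)) (zeroˡ _)))
    (*-congˡ (reflexive (cong (λ u → h ((K ∸ j) ∷ u)) (zipWith-identityʳ (λ _ → ≡.refl) w))))))

  ⊗-IsSeriesInYʳ : ∀ {g h} → IsSeriesInY h → ∀ K w → (g ⊗ h) (K ∷ w) ≈ (yCoeffs g w ⋆ yCoeffs₀ h) K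
  ⊗-IsSeriesInYʳ {g} {h} h∈Y K w = trans (sumL-below-∷ K w _) (∑-cong (suc K) (λ j _ → trans
    (sumL-below-top w _ (λ d ne → trans (*-congˡ (h∈Y (K ∸ j) _ ne)) (zeroʳ _)))
    (*-congˡ (reflexive (cong (λ u → h ((K ∸ j) ∷ u)) w∸w≡0)))))
    where
    w∸w≡0 : Vec.zipWith _∸_ w w ≡ replicate m 0
    w∸w≡0 = ≡.trans (cong (Vec.zipWith _∸_ w) (≡.sym (map-id w))) (zipWith-inverseʳ n∸n≡0 w)

  term-≡ : ∀ a d → term a d d ≈ a
  term-≡ a d with ≡-dec _≟_ d d
  ... | yes _   = refl
  ... | no  d≢d = contradiction ≡.refl d≢d

  term-≢ : ∀ a {d e} → d ≢ e → term a d e ≈ 0#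
  term-≢ a {d} {e} d≢e with ≡-dec _≟_ d e
  ... | yes d≡e = contradiction d≡e d≢e
  ... | no  _   = refl

  IsSeriesInY-yPow : ∀ a k → IsSeriesInY (term a (yPow k))
  IsSeriesInY-yPow a k j d d≢0 = term-≢ a {yPow k} {j ∷ d} (d≢0 ∘ ≡.sym ∘ cong Vec.tail)

  IsSeriesInY-⊗ : ∀ {g h} → IsSeriesInY g → IsSeriesInY h → IsSeriesInY (g ⊗ h)
  IsSeriesInY-⊗ {g} {h} g∈Y h∈Y j d d≢0 =
    trans (⊗-IsSeriesInYˡ {g} {h} g∈Y j d) (⋆-vanishesʳ j (λ s _ → h∈Y s d d≢0))

  IsSeriesInY-geom : IsSeriesInY geom
  IsSeriesInY-geom j = IsSeriesInY-yPow 1# j j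

  IsSeriesInY-geom^ : ∀ i → IsSeriesInY (geom ^ₛ i)
  IsSeriesInY-geom^ zero    = IsSeriesInY-yPow 1# 0
  IsSeriesInY-geom^ (suc i) =
    IsSeriesInY-⊗ {geom} {geom ^ₛ i} IsSeriesInY-geom (IsSeriesInY-geom^ i)

  IsSeriesInY-binomNeg : ∀ α → IsSeriesInY (binomNeg α)
  IsSeriesInY-binomNeg α j = IsSeriesInY-yPow _ j j

  fromℕ-+ : ∀ a b → fromℕ (a ℕ.+ b) ≈ fromℕ a + fromℕ b
  fromℕ-+ zero    b = sym (+-identityˡ _)
  fromℕ-+ (suc a) b = trans (+-congˡ (fromℕ-+ a b)) (sym (+-assoc _ _ _))

  ι-fromℕ : ∀ n → ι (+ n / 1) ≈ fromℕ n
  ι-fromℕ zero    = 0#-homo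
  ι-fromℕ (suc n) = trans (reflexive (cong ι ([1+n]/1≡1+n/1 n)))
                          (trans (+-homo _ _) (+-cong 1#-homo (ι-fromℕ n)))

  invFact-suc : ∀ k → invFact k ≈ fromℕ (suc k) * invFact (suc k)
  invFact-suc k = trans (reflexive (cong ι (1/n≡[1+a]/1*1/[[1+a]*n] k (k !) {{k !≢0}})))
                        (trans (*-homo _ _) (*-congʳ (ι-fromℕ (suc k))))

  poch-cong : ∀ k {a b} → a ≈ b → poch a k ≈ poch b k
  poch-cong zero    _   = refl
  poch-cong (suc k) a≈b = *-cong (poch-cong k a≈b) (+-congʳ a≈b)

  poch-+ : ∀ α i k → poch α (i ℕ.+ k) ≈ poch α i * poch (α + fromℕ i) k
  poch-+ α i zero    = trans (reflexive (cong (poch α) (ℕ.+-identityʳ i))) (sym (*-identityʳ _))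
  poch-+ α i (suc k) = begin
    poch α (i ℕ.+ suc k)
      ≡⟨ cong (poch α) (ℕ.+-suc i k) ⟩
    poch α (i ℕ.+ k) * (α + fromℕ (i ℕ.+ k))
      ≈⟨ *-cong (poch-+ α i k) (+-congˡ (fromℕ-+ i k)) ⟩
    (poch α i * poch (α + fromℕ i) k) * (α + (fromℕ i + fromℕ k))
      ≈⟨ solve 5 (λ p q a x y → (p :* q) :* (a :+ (x :+ y)) := p :* (q :* ((a :+ x) :+ y))) refl
           (poch α i) (poch (α + fromℕ i) k) α (fromℕ i) (fromℕ k) ⟩
    poch α i * poch (α + fromℕ i) (suc k) ∎

  poch-suc : ∀ β k → poch β (suc k) ≈ β * poch (β + 1#) k
  poch-suc β k = trans (poch-+ β 1 k)
    (*-cong (trans (*-identityˡ _) (+-identityʳ β)) (poch-cong k (+-congˡ (+-identityʳ 1#))))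

  negBinomCoeff : Carrier → ℕ → Carrier
  negBinomCoeff β t = poch β t * invFact t

  ∑-negBinomCoeff : ∀ β t → ∑[ j < suc t ] negBinomCoeff β j ≈ negBinomCoeff (β + 1#) t
  ∑-negBinomCoeff β zero    = +-identityˡ _
  ∑-negBinomCoeff β (suc t) = begin
    ∑[ j < suc t ] negBinomCoeff β j + poch β (suc t) * invFact (suc t)
      ≈⟨ +-cong (∑-negBinomCoeff β t) (*-congʳ (poch-suc β t)) ⟩
    poch (β + 1#) t * invFact t + (β * poch (β + 1#) t) * invFact (suc t)
      ≈⟨ +-congʳ (*-congˡ (invFact-suc t)) ⟩
    poch (β + 1#) t * ((1# + fromℕ t) * invFact (suc t)) + (β * poch (β + 1#) t) * invFact (suc t)
      ≈⟨ solve 5 (λ p x i b one →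
             p :* ((one :+ x) :* i) :+ (b :* p) :* i := (p :* ((b :+ one) :+ x)) :* i) refl (poch (β + 1#) t) (fromℕ t) (invFact (suc t)) β 1# ⟩
    negBinomCoeff (β + 1#) (suc t) ∎

  negBinomCoeff-⋆-geom^ : ∀ β i t →
    (negBinomCoeff β ⋆ yCoeffs₀ (geom ^ₛ i)) t ≈ negBinomCoeff (β + fromℕ i) t
  negBinomCoeff-⋆-geom^ β zero t = begin
    (negBinomCoeff β ⋆ yCoeffs₀ oneₛ) t
      ≈⟨ ⋆-comm (negBinomCoeff β) (yCoeffs₀ oneₛ) t ⟩
    (yCoeffs₀ oneₛ ⋆ negBinomCoeff β) t
      ≈⟨ ⋆-concentratedˡ {yCoeffs₀ oneₛ} {negBinomCoeff β} {0} {t}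
           (λ j j≢0 → term-≢ 1# {yPow 0} {yPow j} (j≢0 ∘ ≡.sym ∘ cong Vec.head)) z≤n ⟩
    yCoeffs₀ oneₛ 0 * negBinomCoeff β t
      ≈⟨ trans (*-congʳ (term-≡ 1# (yPow 0))) (*-identityˡ _) ⟩
    negBinomCoeff β t
      ≈⟨ *-congʳ (poch-cong t (sym (+-identityʳ β))) ⟩
    negBinomCoeff (β + 0#) t ∎
  negBinomCoeff-⋆-geom^ β (suc i) t = begin
    (negBinomCoeff β ⋆ yCoeffs₀ (geom ⊗ (geom ^ₛ i))) t
      ≈⟨ ⋆-cong t (λ _ _ → refl) (λ s _ →
           trans (⊗-IsSeriesInYˡ {geom} {geom ^ₛ i} IsSeriesInY-geom s (replicate m 0))
                 (⋆-comm (yCoeffs₀ geom) (yCoeffs₀ (geom ^ₛ i)) s)) ⟩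
    (negBinomCoeff β ⋆ (yCoeffs₀ (geom ^ₛ i) ⋆ yCoeffs₀ geom)) t
      ≈⟨ ⋆-assoc (negBinomCoeff β) (yCoeffs₀ (geom ^ₛ i)) (yCoeffs₀ geom) t ⟨
    ((negBinomCoeff β ⋆ yCoeffs₀ (geom ^ₛ i)) ⋆ yCoeffs₀ geom) t
      ≈⟨ ⋆-cong t (λ s _ → negBinomCoeff-⋆-geom^ β i s) (λ s _ → term-≡ 1# (yPow s)) ⟩
    (negBinomCoeff (β + fromℕ i) ⋆ (λ _ → 1#)) t
      ≈⟨ ⋆-ones _ t ⟩
    ∑[ j < suc t ] negBinomCoeff (β + fromℕ i) j
      ≈⟨ ∑-negBinomCoeff _ t ⟩
    negBinomCoeff ((β + fromℕ i) + 1#) t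
      ≈⟨ *-congʳ (poch-cong t (trans (+-assoc _ _ _) (+-congˡ (+-comm _ _)))) ⟩
    negBinomCoeff (β + fromℕ (suc i)) t ∎

  uniformBound : ∀ {f} → Admissible f → ∀ K w →
    Σ[ B ∈ ℕ ] (∀ i l → B ≤ i → l ≤ K → f i (l ∷ w) ≈ 0#)
  uniformBound (N , N-ok) K w =
    maxUpTo (λ l → N (l ∷ w)) K ,
    λ i l B≤i l≤K → N-ok (l ∷ w) i (≤-trans (≤-maxUpTo (λ l → N (l ∷ w)) K l≤K) B≤i)

  module _ (α : Carrier) (f : ZSeries) (K : ℕ) (w : Vec ℕ m) (B : ℕ)
           (f-vanishes : ∀ i l → B ≤ i → l ≤ K → f i (l ∷ w) ≈ 0#) where

    reducedCoeff : Carrier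
    reducedCoeff = ∑[ i < B ] ((negBinomCoeff (α + fromℕ i) ⋆ yCoeffs (f i) w) K * poch α i)

    𝓛-expY⋆-coeff : (a : Admissible (expY⋆ f)) → 𝓛 α (expY⋆ f) a (K ∷ w) ≈ reducedCoeff
    𝓛-expY⋆-coeff (N , N-ok) = begin
      𝓛 α (expY⋆ f) (N , N-ok) (K ∷ w)
        ≈⟨ sumL-upTo (N (K ∷ w)) _ ⟩
      ∑[ n < N (K ∷ w) ] (E n * poch α n)
        ≈⟨ ∑-extend M (λ n N≤n → trans (*-congʳ (N-ok (K ∷ w) n N≤n)) (zeroˡ _)) (m≤m+n _ _) ⟨
      ∑[ n < M ] (E n * poch α n)
        ≈⟨ ∑-cong M (λ n _ → E*poch n) ⟩
      ∑[ n < M ] ∑[ k < suc n ] a k (n ∸ k)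
        ≈⟨ ∑-antidiagonal M a a-vanishesₖ a-vanishesᵢ (m≤n+m _ _) ⟩
      ∑[ k < suc K ] ∑[ i < B ] a k i
        ≈⟨ ∑-comm (suc K) B a ⟩
      ∑[ i < B ] ∑[ k < suc K ] a k i
        ≈⟨ ∑-cong B (λ i _ → ∑ₖa i) ⟩
      reducedCoeff ∎
      where
      E : ℕ → Carrier
      E n = expY⋆ f n (K ∷ w)

      M : ℕ
      M = N (K ∷ w) ℕ.+ (suc K ℕ.+ B)

      expYTerm : ℕ → ℕ → Carrier
      expYTerm k = yCoeffs₀ (term (invFact k) (yPow k))

      a : ℕ → ℕ → Carrier
      a k i = (expYTerm k ⋆ yCoeffs (f i) w) K * poch α (k ℕ.+ i)

      E*poch : ∀ n → E n * poch α n ≈ ∑[ k < suc n ] a k (n ∸ k)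
      E*poch n = begin
        E n * poch α n
          ≈⟨ *-congʳ (sumS-upTo (suc n) (λ k → term (invFact k) (yPow k) ⊗ f (n ∸ k)) (K ∷ w)) ⟩
        ∑[ k < suc n ] (term (invFact k) (yPow k) ⊗ f (n ∸ k)) (K ∷ w) * poch α n
          ≈⟨ *-distribʳ-∑ (suc n) _ _ ⟩
        ∑[ k < suc n ] ((term (invFact k) (yPow k) ⊗ f (n ∸ k)) (K ∷ w) * poch α n)
          ≈⟨ ∑-cong (suc n) (λ k k<1+n → *-cong
               (⊗-IsSeriesInYˡ {term (invFact k) (yPow k)} {f (n ∸ k)} (IsSeriesInY-yPow _ k) K w)
               (reflexive (cong (poch α) (≡.sym (m+[n∸m]≡n (m<1+n⇒m≤n k<1+n)))))) ⟩
        ∑[ k < suc n ] a k (n ∸ k) ∎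

      a-vanishesₖ : ∀ k i → suc K ≤ k → a k i ≈ 0#
      a-vanishesₖ k i K<k = trans (*-congʳ (⋆-vanishesˡ {expYTerm k} {yCoeffs (f i) w} K (λ s s≤K →
        term-≢ _ {yPow k} {yPow s} (λ k≡s → <⇒≢ (≤-<-trans s≤K K<k) (≡.sym (cong Vec.head k≡s))))))
        (zeroˡ _)

      a-vanishesᵢ : ∀ k i → B ≤ i → a k i ≈ 0#
      a-vanishesᵢ k i B≤i = trans (*-congʳ (⋆-vanishesʳ {expYTerm k} {yCoeffs (f i) w} K (λ s s≤K →
        f-vanishes i s B≤i s≤K))) (zeroˡ _)

      ∑ₖa : ∀ i →
        ∑[ k < suc K ] a k i ≈ (negBinomCoeff (α + fromℕ i) ⋆ yCoeffs (f i) w) K * poch α i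
      ∑ₖa i = begin
        ∑[ k < suc K ] a k i
          ≈⟨ ∑-cong (suc K) (λ k k<1+K → summand k (m<1+n⇒m≤n k<1+K)) ⟩
        ∑[ k < suc K ] (negBinomCoeff (α + fromℕ i) k * yCoeffs (f i) w (K ∸ k) * poch α i)
          ≈⟨ *-distribʳ-∑ (suc K) (poch α i) _ ⟨
        (negBinomCoeff (α + fromℕ i) ⋆ yCoeffs (f i) w) K * poch α i ∎
        where
        summand : ∀ k → k ≤ K →
          a k i ≈ negBinomCoeff (α + fromℕ i) k * yCoeffs (f i) w (K ∸ k) * poch α i
        summand k k≤K = begin
          (expYTerm k ⋆ yCoeffs (f i) w) K * poch α (k ℕ.+ i)
            ≈⟨ *-cong (⋆-concentratedˡ {expYTerm k} {yCoeffs (f i) w}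
                         (λ j j≢k → term-≢ _ {yPow k} {yPow j} (j≢k ∘ ≡.sym ∘ cong Vec.head)) k≤K)
                      (trans (reflexive (cong (poch α) (ℕ.+-comm k i))) (poch-+ α i k)) ⟩
          expYTerm k k * yCoeffs (f i) w (K ∸ k) * (poch α i * poch (α + fromℕ i) k)
            ≈⟨ *-congʳ (*-congʳ (term-≡ _ (yPow k))) ⟩
          invFact k * yCoeffs (f i) w (K ∸ k) * (poch α i * poch (α + fromℕ i) k)
            ≈⟨ solve 4 (λ x y p q → x :* y :* (p :* q) := q :* x :* y :* p) refl
                 (invFact k) (yCoeffs (f i) w (K ∸ k)) (poch α i) (poch (α + fromℕ i) k) ⟩
          negBinomCoeff (α + fromℕ i) k * yCoeffs (f i) w (K ∸ k) * poch α i ∎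

    binomNeg⊗𝓛-substGeom-coeff : (a : Admissible (substGeom f)) →
      (binomNeg α ⊗ 𝓛 α (substGeom f) a) (K ∷ w) ≈ reducedCoeff
    binomNeg⊗𝓛-substGeom-coeff (N , N-ok) = begin
      (binomNeg α ⊗ L) (K ∷ w)
        ≈⟨ ⊗-IsSeriesInYˡ {binomNeg α} {L} (IsSeriesInY-binomNeg α) K w ⟩
      (yCoeffs₀ (binomNeg α) ⋆ yCoeffs L w) K
        ≈⟨ ⋆-cong K (λ j _ → term-≡ _ (yPow j)) L-coeff ⟩
      (negBinomCoeff α ⋆ (λ t → ∑[ i < B ] ((yCoeffs (f i) w ⋆ G i) t * poch α i))) K
        ≈⟨ ⋆-distribˡ-∑ B (negBinomCoeff α) (λ i → yCoeffs (f i) w ⋆ G i) (poch α) K ⟩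
      ∑[ i < B ] ((negBinomCoeff α ⋆ (yCoeffs (f i) w ⋆ G i)) K * poch α i)
        ≈⟨ ∑-cong B (λ i _ → *-congʳ (reassociate i)) ⟩
      reducedCoeff ∎
      where
      L : Series
      L = 𝓛 α (substGeom f) (N , N-ok)

      G : ℕ → ℕ → Carrier
      G i = yCoeffs₀ (geom ^ₛ i)

      substGeom-coeff : ∀ i t → substGeom f i (t ∷ w) ≈ (yCoeffs (f i) w ⋆ G i) t
      substGeom-coeff i t = ⊗-IsSeriesInYʳ {f i} {geom ^ₛ i} (IsSeriesInY-geom^ i) t w

      L-coeff : ∀ t → t ≤ K → L (t ∷ w) ≈ ∑[ i < B ] ((yCoeffs (f i) w ⋆ G i) t * poch α i)
      L-coeff t t≤K = begin
        L (t ∷ w)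
          ≈⟨ sumL-upTo (N (t ∷ w)) _ ⟩
        ∑[ i < N (t ∷ w) ] (substGeom f i (t ∷ w) * poch α i)
          ≈⟨ ∑-bound-irrelevant (N (t ∷ w)) B
               (λ i N≤i → trans (*-congʳ (N-ok (t ∷ w) i N≤i)) (zeroˡ _))
               (λ i B≤i → trans (*-congʳ (trans (substGeom-coeff i t)
                 (⋆-vanishesˡ {yCoeffs (f i) w} {G i} t (λ s s≤t →
                   f-vanishes i s B≤i (≤-trans s≤t t≤K))))) (zeroˡ _)) ⟩
        ∑[ i < B ] (substGeom f i (t ∷ w) * poch α i)
          ≈⟨ ∑-cong B (λ i _ → *-congʳ (substGeom-coeff i t)) ⟩
        ∑[ i < B ] ((yCoeffs (f i) w ⋆ G i) t * poch α i) ∎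

      reassociate : ∀ i → (negBinomCoeff α ⋆ (yCoeffs (f i) w ⋆ G i)) K
                        ≈ (negBinomCoeff (α + fromℕ i) ⋆ yCoeffs (f i) w) K
      reassociate i = begin
        (negBinomCoeff α ⋆ (yCoeffs (f i) w ⋆ G i)) K
          ≈⟨ ⋆-cong K (λ _ _ → refl) (λ s _ → ⋆-comm (yCoeffs (f i) w) (G i) s) ⟩
        (negBinomCoeff α ⋆ (G i ⋆ yCoeffs (f i) w)) K
          ≈⟨ ⋆-assoc (negBinomCoeff α) (G i) (yCoeffs (f i) w) K ⟨
        ((negBinomCoeff α ⋆ G i) ⋆ yCoeffs (f i) w) K
          ≈⟨ ⋆-cong {b = yCoeffs (f i) w} K (λ s _ → negBinomCoeff-⋆-geom^ α i s) (λ _ _ → refl) ⟩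
        (negBinomCoeff (α + fromℕ i) ⋆ yCoeffs (f i) w) K ∎

lemma3p1 : ∀ {c ℓ} (F : RatField c ℓ) (m : ℕ) (α : RatField.Carrier F)
    (f : PowerSeries.ZSeries F m)
    (af : PowerSeries.Admissible F m f)
    (a₁ : PowerSeries.Admissible F m (PowerSeries.expY⋆ F m f))
    (a₂ : PowerSeries.Admissible F m (PowerSeries.substGeom F m f)) →
    PowerSeries._≈ₛ_ F m
      (PowerSeries.𝓛 F m α (PowerSeries.expY⋆ F m f) a₁)
      (PowerSeries._⊗_ F m (PowerSeries.binomNeg F m α)
        (PowerSeries.𝓛 F m α (PowerSeries.substGeom F m f) a₂))
lemma3p1 F m α f af a₁ a₂ (K ∷ w) =
  let B , f-vanishes = uniformBound af K w
  in trans (𝓛-expY⋆-coeff α f K w B f-vanishes a₁)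
           (sym (binomNeg⊗𝓛-substGeom-coeff α f K w B f-vanishes a₂))
  where
  open RatField F using (trans; sym)
  open PowerSeriesProperties F m
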